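{- Let $k\ge 2$ be an integer and let $H$ be a $(2k+1,k)$-bigraph with parts $A,B$. If $H$ has a 1-factor, then there exists $v'\in A$ such that for every $v\in A\setminus\{v'\}$ there exist 1-factors $M_1^v$ and $M_2^v$ of $H$ whose edges incident with $v$ are distinct.
   Context: A bigraph is a bipartite graph with parts $A$ and $B$ such that $|A|=|B|$. An $(s,t)$-bigraph is a bigraph with $|A|=|B|=s$ and minimum degree at least $t$. -}

module Defs where

open import Data.Nat using (ℕ; _≤_)
open import Data.Fin using (Fin)
open import Data.Bool using (Bool; true)
open import Data.Fin.Subset using (Subset; ∣_∣)
open import Data.Vec using (tabulate)
open import Data.Product using (_×_)
open import Relation.Binary.PropositionalEquality using (_≡_)
open import Function.Definitions using (Injective)

-- A bigraph with parts A = Fin s and B = Fin s, given by its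
-- bipartite adjacency: adj a b ≡ true iff a ∈ A and b ∈ B are adjacent.
record Bigraph (s : ℕ) : Set where
  field
    adj : Fin s → Fin s → Bool

open Bigraph public

nbrA : ∀ {s} → Bigraph s → Fin s → Subset s
nbrA H a = tabulate (λ b → adj H a b)

nbrB : ∀ {s} → Bigraph s → Fin s → Subset s
nbrB H b = tabulate (λ a → adj H a b)

degA : ∀ {s} → Bigraph s → Fin s → ℕ
degA H a = ∣ nbrA H a ∣

degB : ∀ {s} → Bigraph s → Fin s → ℕ
degB H b = ∣ nbrB H b ∣

IsSTBigraph : (s t : ℕ) → Bigraph s → Set
IsSTBigraph s t H = (∀ a → t ≤ degA H a) × (∀ b → t ≤ degB H b)

-- A 1-factor (perfect matching) of a bigraph with parts of size s:
-- every a ∈ A is matched to the vertex (match a) ∈ B, the edge a–(match a)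
-- is an edge of H, and distinct vertices of A are matched to distinct
-- vertices of B (so match is a bijection A → B, as |A| = |B|).
-- The edge of the 1-factor incident with a ∈ A is {a, match a}.
record OneFactor {s : ℕ} (H : Bigraph s) : Set where
  field
    match     : Fin s → Fin s
    injective : Injective _≡_ _≡_ match
    isEdge    : ∀ a → adj H a (match a) ≡ true

open OneFactor public

-- Let M be the given 1-factor and orient A as a digraph: x → y iff x ≠ y and x is adjacent to
-- M y.  If v lies on a directed cycle, re-matching every vertex of the cycle to the partner of
-- its successor is a second 1-factor that moves the edge at v.  If v lies on no cycle, the sets
-- F of vertices reachable from v and B of vertices reaching v are disjoint and closed, and the
-- minimum degree k ≥ 2 forces |F|, |B| ≥ k, so F, B and v fill all 2k + 1 vertices.  A second
-- such vertex w cannot fit: w ∈ F gives k ≤ |F_w| < |F| (and likewise for B), while w ∉ F ∪ B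
-- would be a (2k + 2)-nd vertex.

module Submission where

open import Defs
open import Level using (0ℓ)
open import Data.Nat using (ℕ; zero; suc; _≤_; _<_; _+_; _*_; s≤s; z≤n)
import Data.Nat.Properties as ℕ
open import Data.Bool using (Bool; true)
import Data.Bool.Properties as Bool
open import Data.Fin using (Fin; zero; suc; _≟_; punchOut; fromℕ<)
open import Data.Fin.Properties using (any?; injective⇒≤; punchOut-injective; suc-injective; 0≢1+n)
open import Data.Fin.Permutation using (Permutation′; _⟨$⟩ʳ_; _∘ₚ_; transpose; id)
import Data.Fin.Permutation.Components as PC
open import Data.Fin.Subset
  using (Subset; _∈_; _∉_; _⊆_; _⊂_; _∪_; _-_; ⁅_⁆; ∣_∣; inside; outside) renaming (⊥ to ∅)
open import Data.Fin.Subset.Properties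
  using ( _∈?_; ∉⊥; ∣p∣≤n; p⊆q⇒∣p∣≤∣q∣; p⊂q⇒∣p∣<∣q∣; p⊆p∪q; x∈p∪q⁺; x∈p∪q⁻; x∈⁅x⁆; x∈⁅y⁆⇒x≡y
        ; ∣⁅x⁆∣≡1; x∈p∧x≢y⇒x∈p-y; x∈p⇒∣p-x∣<∣p∣)
open import Data.Vec using (_∷_; []; tabulate; here; there)
open import Data.Vec.Properties using (lookup∘tabulate; []=⇒lookup; lookup⇒[]=)
open import Data.Product using (Σ; ∃; ∃₂; _×_; _,_; proj₁; proj₂)
open import Data.Sum using (_⊎_; inj₁; inj₂; [_,_]; map₂; fromInj₁)
open import Data.Empty using (⊥-elim)
open import Relation.Nullary using (¬_; Dec; yes; no; ¬?; _×-dec_; _⊎-dec_)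
open import Relation.Nullary.Decidable using (decidable-stable; dec-true; dec-false)
open import Relation.Unary using (Pred)
open import Relation.Binary using (Rel; Decidable; Sym)
open import Relation.Binary.Construct.Closure.ReflexiveTransitive using (Star; ε; _◅_; _◅◅_; reverse)
open import Relation.Binary.PropositionalEquality using (_≡_; _≢_; refl; sym; trans; cong; subst)
open import Function using (_∘_; flip)
open import Function.Bundles using (Injection)
open import Function.Definitions using (Injective)
open import Function.Properties.Inverse using (↔⇒↣)

module _ {n : ℕ} where

  ∈-tabulate⁺ : ∀ {f : Fin n → Bool} {x} → f x ≡ true → x ∈ tabulate f
  ∈-tabulate⁺ {f} {x} fx = lookup⇒[]= x (tabulate f) (trans (lookup∘tabulate f x) fx)

  ∈-tabulate⁻ : ∀ {f : Fin n → Bool} {x} → x ∈ tabulate f → f x ≡ true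
  ∈-tabulate⁻ {f} {x} x∈ = trans (sym (lookup∘tabulate f x)) ([]=⇒lookup x∈)

  x∉p⇒∣p∣<∣p∪⁅x⁆∣ : ∀ {p : Subset n} {x} → x ∉ p → ∣ p ∣ < ∣ p ∪ ⁅ x ⁆ ∣
  x∉p⇒∣p∣<∣p∪⁅x⁆∣ {x = x} x∉p = p⊂q⇒∣p∣<∣q∣ (p⊆p∪q ⁅ x ⁆ , x , x∈p∪q⁺ (inj₂ (x∈⁅x⁆ x)) , x∉p)

  1<∣p∣⇒∃≢ : ∀ {p : Subset n} → 1 < ∣ p ∣ → ∀ x → ∃ λ y → y ∈ p × y ≢ x
  1<∣p∣⇒∃≢ {p} 1<∣p∣ x with any? (λ y → y ∈? p ×-dec ¬? (y ≟ x))
  ... | yes found = found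
  ... | no none = ⊥-elim (ℕ.<⇒≱ 1<∣p∣ (subst (∣ p ∣ ≤_) (∣⁅x⁆∣≡1 x) (p⊆q⇒∣p∣≤∣q∣ p⊆⁅x⁆)))
    where
    p⊆⁅x⁆ : p ⊆ ⁅ x ⁆
    p⊆⁅x⁆ {y} y∈p = subst (_∈ ⁅ x ⁆) (sym y≡x) (x∈⁅x⁆ x)
      where
      y≡x : y ≡ x
      y≡x = decidable-stable (y ≟ x) (λ y≢x → none (y , y∈p , y≢x))

∣p∪q∣≡∣p∣+∣q∣ : ∀ {n} {p q : Subset n} → (∀ {x} → x ∈ p → x ∉ q) → ∣ p ∪ q ∣ ≡ ∣ p ∣ + ∣ q ∣
∣p∪q∣≡∣p∣+∣q∣ {p = []}          {[]}          _    = refl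
∣p∪q∣≡∣p∣+∣q∣ {p = inside  ∷ p} {inside  ∷ q} disj = ⊥-elim (disj here here)
∣p∪q∣≡∣p∣+∣q∣ {p = inside  ∷ p} {outside ∷ q} disj =
  cong suc (∣p∪q∣≡∣p∣+∣q∣ (λ x∈p → disj (there x∈p) ∘ there))
∣p∪q∣≡∣p∣+∣q∣ {p = outside ∷ p} {inside  ∷ q} disj =
  trans (cong suc (∣p∪q∣≡∣p∣+∣q∣ (λ x∈p → disj (there x∈p) ∘ there))) (sym (ℕ.+-suc _ _))
∣p∪q∣≡∣p∣+∣q∣ {p = outside ∷ p} {outside ∷ q} disj = ∣p∪q∣≡∣p∣+∣q∣ (λ x∈p → disj (there x∈p) ∘ there)

injection⇒∣p∣≤∣q∣ : ∀ {m n} {f : Fin m → Fin n} → Injective _≡_ _≡_ f →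
                    (p : Subset m) (q : Subset n) → (∀ {x} → x ∈ p → f x ∈ q) → ∣ p ∣ ≤ ∣ q ∣
injection⇒∣p∣≤∣q∣ f-inj [] q f[p]⊆q = z≤n
injection⇒∣p∣≤∣q∣ f-inj (outside ∷ p) q f[p]⊆q =
  injection⇒∣p∣≤∣q∣ (suc-injective ∘ f-inj) p q (f[p]⊆q ∘ there)
injection⇒∣p∣≤∣q∣ {f = f} f-inj (inside ∷ p) q f[p]⊆q =
  ℕ.≤-trans (s≤s (injection⇒∣p∣≤∣q∣ (suc-injective ∘ f-inj) p (q - f zero) f[p]⊆q-f₀))
            (x∈p⇒∣p-x∣<∣p∣ (f[p]⊆q here))
  where
  f[p]⊆q-f₀ : ∀ {x} → x ∈ p → f (suc x) ∈ q - f zero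
  f[p]⊆q-f₀ x∈p = x∈p∧x≢y⇒x∈p-y (f[p]⊆q (there x∈p)) (0≢1+n ∘ sym ∘ f-inj)

injective⇒surjective : ∀ {n} {f : Fin n → Fin n} → Injective _≡_ _≡_ f → ∀ y → ∃ λ x → f x ≡ y
injective⇒surjective {zero}          _     ()
injective⇒surjective {suc n} {f = f} f-inj y with any? (λ x → f x ≟ y)
... | yes hit = hit
... | no miss = ⊥-elim (ℕ.1+n≰n (injective⇒≤ g-inj))
  where
  g : Fin (suc n) → Fin n
  g x = punchOut {i = y} (miss ∘ (x ,_) ∘ sym)
  g-inj : Injective _≡_ _≡_ g
  g-inj {x} {x′} = f-inj ∘ punchOut-injective {i = y} (miss ∘ (x ,_) ∘ sym) (miss ∘ (x′ ,_) ∘ sym)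

∃⊎∀ : ∀ {n} {P Q : Pred (Fin n) 0ℓ} → (∀ i → P i ⊎ Q i) → ∃ Q ⊎ (∀ i → P i)
∃⊎∀ {zero}          _     = inj₂ λ ()
∃⊎∀ {suc n} {P} {Q} P⊎Q with P⊎Q zero | ∃⊎∀ {P = P ∘ suc} {Q ∘ suc} (P⊎Q ∘ suc)
... | inj₂ q₀ | _            = inj₁ (zero , q₀)
... | inj₁ _  | inj₁ (i , q) = inj₁ (suc i , q)
... | inj₁ p₀ | inj₂ ps      = inj₂ λ { zero → p₀ ; (suc i) → ps i }

all-but-one : ∀ {n} {P Q : Pred (Fin n) 0ℓ} → Fin n → (∀ i → P i ⊎ Q i) →
              (∀ {i j} → Q i → Q j → i ≡ j) → ∃ λ j → ∀ i → i ≢ j → P i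
all-but-one i₀ P⊎Q Q-unique with ∃⊎∀ P⊎Q
... | inj₁ (j , qⱼ) = j , λ i i≢j → fromInj₁ (λ qᵢ → ⊥-elim (i≢j (Q-unique qᵢ qⱼ))) (P⊎Q i)
... | inj₂ ps       = i₀ , λ i _ → ps i

module _ {n : ℕ} where

  transpose-here : ∀ (i j : Fin n) → PC.transpose i j i ≡ j
  transpose-here i j rewrite dec-true (i ≟ i) refl = refl

  transpose-there : ∀ (i j : Fin n) → PC.transpose i j j ≡ i
  transpose-there i j with j ≟ i
  ... | yes j≡i = j≡i
  ... | no  _   rewrite dec-true (j ≟ j) refl = refl

  transpose-elsewhere : ∀ {i j k : Fin n} → k ≢ i → k ≢ j → PC.transpose i j k ≡ k
  transpose-elsewhere {i} {j} {k} k≢i k≢j rewrite dec-false (k ≟ i) k≢i | dec-false (k ≟ j) k≢j = refl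

  ⟨$⟩ʳ-injective : ∀ (π : Permutation′ n) {x y} → π ⟨$⟩ʳ x ≡ π ⟨$⟩ʳ y → x ≡ y
  ⟨$⟩ʳ-injective π = Injection.injective (↔⇒↣ π)

module _ {n : ℕ} (G : Rel (Fin n) 0ℓ) where

  Closed : Subset n → Set
  Closed S = ∀ {x y} → x ∈ S → G x y → y ∈ S

  Closed-Star : ∀ {S} → Closed S → ∀ {x y} → x ∈ S → Star G x y → y ∈ S
  Closed-Star S-closed x∈S ε        = x∈S
  Closed-Star S-closed x∈S (g ◅ gs) = Closed-Star S-closed (S-closed x∈S g) gs

  record Rotation (w : Fin n) : Set where
    field
      σ       : Permutation′ n
      moves   : σ ⟨$⟩ʳ w ≢ w
      follows : ∀ z → σ ⟨$⟩ʳ z ≡ z ⊎ G z (σ ⟨$⟩ʳ z)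

  record Cycle (w : Fin n) : Set where
    field
      {last}   : Fin n
      path     : Star G w last
      closing  : G last w
      rotation : Rotation w

  record OutClosure (w : Fin n) : Set where
    field
      set       : Subset n
      root∉     : w ∉ set
      out⊆      : ∀ {y} → G w y → y ∈ set
      closed    : Closed set
      reachable : ∀ {x} → x ∈ set → Star G w x

    cannot-return : ∀ {x} → x ∈ set → ¬ Star G x w
    cannot-return x∈set = root∉ ∘ Closed-Star closed x∈set

  open OutClosure

  OutClosure-⊂ : ∀ {u w} (F : OutClosure u) (F′ : OutClosure w) → w ∈ set F → set F′ ⊂ set F
  OutClosure-⊂ F F′ w∈F = (Closed-Star (closed F) w∈F ∘ reachable F′) , _ , w∈F , root∉ F′

module _ {n : ℕ} {G G′ : Rel (Fin n) 0ℓ} (rev : Sym G′ G) where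
  open OutClosure

  OutClosures-disjoint : ∀ {u} (F : OutClosure G u) (B : OutClosure G′ u) →
                         ∀ {x} → x ∈ set F → x ∉ set B
  OutClosures-disjoint F B x∈F = cannot-return F x∈F ∘ reverse rev ∘ reachable B

  OutClosure⇒¬Cycle : ∀ {w} → OutClosure G w → ¬ Cycle G′ w
  OutClosure⇒¬Cycle F c = cannot-return F (out⊆ F (rev closing)) (reverse rev path)
    where open Cycle c

module Search {n : ℕ} {G : Rel (Fin n) 0ℓ} (G? : Decidable G) (irreflexive : ∀ {x} → ¬ G x x)
              (w : Fin n) where

  Discovered : Subset n → Fin n → Set
  Discovered S x = x ≡ w ⊎ x ∈ S

  Discovered-∪ : ∀ {S x} T → Discovered S x → Discovered (S ∪ T) x
  Discovered-∪ T = map₂ (p⊆p∪q T)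

  -- ρ moves every vertex of a simple G-path w → ⋯ → x one step forward and sends x back to w.
  record Shift (S : Subset n) (x : Fin n) : Set where
    field
      ρ       : Permutation′ n
      ends    : ρ ⟨$⟩ʳ x ≡ w
      follows : ∀ {z} → z ≢ x → ρ ⟨$⟩ʳ z ≡ z ⊎ G z (ρ ⟨$⟩ʳ z)
      support : ∀ {z} → ρ ⟨$⟩ʳ z ≢ z → Discovered S z

    ρ-injective : ∀ {y z} → ρ ⟨$⟩ʳ y ≡ ρ ⟨$⟩ʳ z → y ≡ z
    ρ-injective = ⟨$⟩ʳ-injective ρ

  Shift-root : ∀ {S} → Shift S w
  Shift-root = record
    { ρ = id ; ends = refl ; follows = λ _ → inj₁ refl ; support = λ idz≢z → ⊥-elim (idz≢z refl) }

  Shift-∪ : ∀ {S x} T → Shift S x → Shift (S ∪ T) x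
  Shift-∪ T sh = record { Shift sh ; support = Discovered-∪ T ∘ Shift.support sh }

  Shift-extend : ∀ {S x y} → Discovered S x → Shift S x → G x y → ¬ Discovered S y →
                 Shift (S ∪ ⁅ y ⁆) y
  Shift-extend {S} {x} {y} x-disc sh g y-new = record
    { ρ = ρ ∘ₚ transpose w y ; ends = ends′ ; follows = follows′ ; support = support′ }
    where
    open Shift sh
    ρ′ : Fin n → Fin n
    ρ′ z = PC.transpose w y (ρ ⟨$⟩ʳ z)

    ρy≡y : ρ ⟨$⟩ʳ y ≡ y
    ρy≡y = decidable-stable (ρ ⟨$⟩ʳ y ≟ y) (y-new ∘ support)

    ρ′x≡y : ρ′ x ≡ y
    ρ′x≡y = trans (cong (PC.transpose w y) ends) (transpose-here w y)

    ends′ : ρ′ y ≡ w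
    ends′ = trans (cong (PC.transpose w y) ρy≡y) (transpose-there w y)

    ρ′-elsewhere : ∀ {z} → z ≢ x → z ≢ y → ρ′ z ≡ ρ ⟨$⟩ʳ z
    ρ′-elsewhere z≢x z≢y = transpose-elsewhere (z≢x ∘ ρ-injective ∘ (λ e → trans e (sym ends)))
                                               (z≢y ∘ ρ-injective ∘ (λ e → trans e (sym ρy≡y)))

    follows′ : ∀ {z} → z ≢ y → ρ′ z ≡ z ⊎ G z (ρ′ z)
    follows′ {z} z≢y with z ≟ x
    ... | yes refl = inj₂ (subst (G z) (sym ρ′x≡y) g)
    ... | no z≢x rewrite ρ′-elsewhere z≢x z≢y = follows z≢x

    support′ : ∀ {z} → ρ′ z ≢ z → Discovered (S ∪ ⁅ y ⁆) z
    support′ {z} ρ′z≢z with z ≟ x | z ≟ y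
    ... | yes refl | _        = Discovered-∪ ⁅ y ⁆ x-disc
    ... | no _     | yes refl = inj₂ (x∈p∪q⁺ (inj₂ (x∈⁅x⁆ y)))
    ... | no z≢x   | no z≢y   =
      Discovered-∪ ⁅ y ⁆ (support (subst (_≢ z) (ρ′-elsewhere z≢x z≢y) ρ′z≢z))

  Shift⇒Rotation : ∀ {S x} → Shift S x → G x w → Rotation G w
  Shift⇒Rotation {x = x} sh g = record { σ = ρ ; moves = moves ; follows = follows′ }
    where
    open Shift sh
    moves : ρ ⟨$⟩ʳ w ≢ w
    moves ρw≡w with ρ-injective (trans ρw≡w (sym ends))
    ... | refl = irreflexive g
    follows′ : ∀ z → ρ ⟨$⟩ʳ z ≡ z ⊎ G z (ρ ⟨$⟩ʳ z)
    follows′ z with z ≟ x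
    ... | yes refl = inj₂ (subst (G z) (sym ends) g)
    ... | no z≢x   = follows z≢x

  record Tree (S : Subset n) : Set where
    field
      root∉ : w ∉ S
      path  : ∀ {x} → Discovered S x → Star G w x
      shift : ∀ {x} → Discovered S x → Shift S x

  Tree-root : Tree ∅
  Tree-root = record { root∉ = ∉⊥ ; path = λ { (inj₁ refl) → ε ; (inj₂ x∈∅) → ⊥-elim (∉⊥ x∈∅) }
                     ; shift = λ { (inj₁ refl) → Shift-root ; (inj₂ x∈∅) → ⊥-elim (∉⊥ x∈∅) } }

  Tree-grow : ∀ {S x y} → Tree S → Discovered S x → G x y → ¬ Discovered S y → Tree (S ∪ ⁅ y ⁆)
  Tree-grow {S} {x} {y} T x-disc g y-new = record { root∉ = root∉′ ; path = path′ ; shift = shift′ }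
    where
    open Tree T
    old-or-new : ∀ {z} → Discovered (S ∪ ⁅ y ⁆) z → Discovered S z ⊎ z ≡ y
    old-or-new (inj₁ z≡w) = inj₁ (inj₁ z≡w)
    old-or-new (inj₂ z∈S∪y) = [ inj₁ ∘ inj₂ , inj₂ ∘ x∈⁅y⁆⇒x≡y y ] (x∈p∪q⁻ S ⁅ y ⁆ z∈S∪y)
    root∉′ : w ∉ S ∪ ⁅ y ⁆
    root∉′ w∈ = [ root∉ , y-new ∘ inj₁ ∘ sym ∘ x∈⁅y⁆⇒x≡y y ] (x∈p∪q⁻ S ⁅ y ⁆ w∈)
    path′ : ∀ {z} → Discovered (S ∪ ⁅ y ⁆) z → Star G w z
    path′ d with old-or-new d
    ... | inj₁ old  = path old
    ... | inj₂ refl = path x-disc ◅◅ (g ◅ ε)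
    shift′ : ∀ {z} → Discovered (S ∪ ⁅ y ⁆) z → Shift (S ∪ ⁅ y ⁆) z
    shift′ d with old-or-new d
    ... | inj₁ old  = Shift-∪ ⁅ y ⁆ (shift old)
    ... | inj₂ refl = Shift-extend x-disc (shift x-disc) g y-new

  Discovered? : ∀ S x → Dec (Discovered S x)
  Discovered? S x = (x ≟ w) ⊎-dec (x ∈? S)

  Frontier : Subset n → Set
  Frontier S = ∃₂ λ x y → Discovered S x × G x y × y ∉ S

  frontier? : ∀ S → Dec (Frontier S)
  frontier? S = any? λ x → any? λ y → Discovered? S x ×-dec G? x y ×-dec ¬? (y ∈? S)

  Tree⇒OutClosure : ∀ {S} → Tree S → ¬ Frontier S → OutClosure G w
  Tree⇒OutClosure {S} T none = record
    { set = S ; root∉ = root∉ ; out⊆ = stays (inj₁ refl) ; closed = stays ∘ inj₂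
    ; reachable = path ∘ inj₂ }
    where
    open Tree T
    stays : ∀ {x y} → Discovered S x → G x y → y ∈ S
    stays {x} {y} d g = decidable-stable (y ∈? S) (λ y∉S → none (x , y , d , g , y∉S))

  explore : ∀ fuel S → n ≤ fuel + ∣ S ∣ → Tree S → Cycle G w ⊎ OutClosure G w
  explore fuel S bound T with frontier? S
  ... | no none = inj₂ (Tree⇒OutClosure T none)
  ... | yes (x , y , x-disc , g , y∉S) with y ≟ w
  ...   | yes refl = inj₁ (record { path = Tree.path T x-disc ; closing = g
                                  ; rotation = Shift⇒Rotation (Tree.shift T x-disc) g })
  ...   | no y≢w  = continue fuel bound
    where
    larger : ∣ S ∣ < ∣ S ∪ ⁅ y ⁆ ∣
    larger = x∉p⇒∣p∣<∣p∪⁅x⁆∣ {p = S} y∉S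
    continue : ∀ fuel → n ≤ fuel + ∣ S ∣ → Cycle G w ⊎ OutClosure G w
    continue zero    bound = ⊥-elim (ℕ.<⇒≱ (ℕ.<-≤-trans larger (∣p∣≤n (S ∪ ⁅ y ⁆))) bound)
    continue (suc f) bound = explore f (S ∪ ⁅ y ⁆)
      (ℕ.≤-trans bound (ℕ.≤-trans (ℕ.≤-reflexive (sym (ℕ.+-suc f ∣ S ∣))) (ℕ.+-monoʳ-≤ f larger)))
      (Tree-grow T x-disc g [ y≢w , y∉S ])

Cycle⊎OutClosure : ∀ {n} {G : Rel (Fin n) 0ℓ} → Decidable G → (∀ {x} → ¬ G x x) →
                   ∀ w → Cycle G w ⊎ OutClosure G w
Cycle⊎OutClosure {n} G? irreflexive w = explore n ∅ (ℕ.m≤m+n n ∣ ∅ {n} ∣) Tree-root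
  where open Search G? irreflexive w

module _ {n : ℕ} (R : Fin n → Fin n → Bool) where

  Strict : Rel (Fin n) 0ℓ
  Strict x y = R x y ≡ true × x ≢ y

  strict? : Decidable Strict
  strict? x y = (R x y Bool.≟ true) ×-dec ¬? (x ≟ y)

  Strict-irreflexive : ∀ {x} → ¬ Strict x x
  Strict-irreflexive (_ , x≢x) = x≢x refl

  OutClosure-size : ∀ {k} → 1 < k → (∀ x → k ≤ ∣ tabulate (R x) ∣) →
                    ∀ {w} (F : OutClosure Strict w) → k ≤ ∣ OutClosure.set F ∣
  OutClosure-size 1<k k≤deg {w} F with 1<∣p∣⇒∃≢ (ℕ.<-≤-trans 1<k (k≤deg w)) w
  ... | y , y∈Rw , y≢w = ℕ.≤-trans (k≤deg y) (p⊆q⇒∣p∣≤∣q∣ Ry⊆F)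
    where
    open OutClosure F
    y∈F : y ∈ set
    y∈F = out⊆ (∈-tabulate⁻ y∈Rw , y≢w ∘ sym)
    Ry⊆F : tabulate (R y) ⊆ set
    Ry⊆F {z} z∈Ry with z ≟ y
    ... | yes refl = y∈F
    ... | no z≢y   = closed y∈F (∈-tabulate⁻ z∈Ry , z≢y ∘ sym)

Strict-flip : ∀ {n} (R : Fin n → Fin n → Bool) → Sym (Strict (flip R)) (Strict R)
Strict-flip R (r , x≢y) = r , x≢y ∘ sym

OffCycle : ∀ {n} → Rel (Fin n) 0ℓ → Rel (Fin n) 0ℓ → Fin n → Set
OffCycle G G′ w = OutClosure G w × OutClosure G′ w

no-room : ∀ {k a b} → k < a → k ≤ b → ¬ (a + b < 2 * k + 1)
no-room {k} {a} {b} k<a k≤b a+b<2k+1 =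
  ℕ.1+n≰n (ℕ.≤-trans (s≤s (ℕ.+-mono-≤ k<a k≤b)) (subst (suc (a + b) ≤_) 2k+1≡1+k+k a+b<2k+1))
  where
  2k+1≡1+k+k : 2 * k + 1 ≡ suc (k + k)
  2k+1≡1+k+k = trans (ℕ.+-comm (2 * k) 1) (cong (λ t → suc (k + t)) (ℕ.+-identityʳ k))

module _ {k} {G G′ : Rel (Fin (2 * k + 1)) 0ℓ} (rev : Sym G′ G)
         (large : ∀ {w} (F : OutClosure G w) → k ≤ ∣ OutClosure.set F ∣)
         (large′ : ∀ {w} (B : OutClosure G′ w) → k ≤ ∣ OutClosure.set B ∣) where
  open OutClosure

  OffCycle-unique : ∀ {u w} → OffCycle G G′ u → OffCycle G G′ w → u ≡ w
  OffCycle-unique {u} {w} (F , B) (F′ , B′) = decidable-stable (u ≟ w) u≢w-impossible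
    where
    X : Subset (2 * k + 1)
    X = set F ∪ set B
    ∣X∣≡∣F∣+∣B∣ : ∣ X ∣ ≡ ∣ set F ∣ + ∣ set B ∣
    ∣X∣≡∣F∣+∣B∣ = ∣p∪q∣≡∣p∣+∣q∣ (OutClosures-disjoint rev F B)
    u∉X : u ∉ X
    u∉X = [ root∉ F , root∉ B ] ∘ x∈p∪q⁻ (set F) (set B)
    room : ∣ set F ∣ + ∣ set B ∣ < 2 * k + 1
    room = subst (_< 2 * k + 1) ∣X∣≡∣F∣+∣B∣ (ℕ.<-≤-trans (x∉p⇒∣p∣<∣p∪⁅x⁆∣ u∉X) (∣p∣≤n (X ∪ ⁅ u ⁆)))
    u≢w-impossible : ¬ u ≢ w
    u≢w-impossible u≢w with w ∈? set F | w ∈? set B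
    ... | yes w∈F | _ =
      no-room (ℕ.≤-<-trans (large F′) (p⊂q⇒∣p∣<∣q∣ (OutClosure-⊂ G F F′ w∈F))) (large′ B) room
    ... | no _ | yes w∈B =
      no-room (ℕ.≤-<-trans (large′ B′) (p⊂q⇒∣p∣<∣q∣ (OutClosure-⊂ G′ B B′ w∈B))) (large F)
              (subst (_< 2 * k + 1) (ℕ.+-comm (∣ set F ∣) _) room)
    ... | no w∉F | no w∉B =
      no-room (s≤s (large F)) (large′ B) (subst (λ t → suc t < 2 * k + 1) ∣X∣≡∣F∣+∣B∣ room′)
      where
      w∉X∪u : w ∉ X ∪ ⁅ u ⁆
      w∉X∪u = [ [ w∉F , w∉B ] ∘ x∈p∪q⁻ (set F) (set B) , u≢w ∘ sym ∘ x∈⁅y⁆⇒x≡y u ] ∘ x∈p∪q⁻ X ⁅ u ⁆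
      room′ : suc ∣ X ∣ < 2 * k + 1
      room′ = ℕ.<-≤-trans (s≤s (x∉p⇒∣p∣<∣p∪⁅x⁆∣ u∉X))
                          (ℕ.<-≤-trans (x∉p⇒∣p∣<∣p∪⁅x⁆∣ w∉X∪u) (∣p∣≤n ((X ∪ ⁅ u ⁆) ∪ ⁅ w ⁆)))

module _ {n} {H : Bigraph n} (M : OneFactor H) where

  Adj : Fin n → Fin n → Bool
  Adj x y = adj H x (match M y)

  TwoFactorsDifferAt : Fin n → Set
  TwoFactorsDifferAt v = Σ (OneFactor H) λ M₁ → Σ (OneFactor H) λ M₂ → match M₁ v ≢ match M₂ v

  Rotation⇒TwoFactorsDifferAt : ∀ {v} → Rotation (Strict Adj) v → TwoFactorsDifferAt v
  Rotation⇒TwoFactorsDifferAt {v} rot = M , M′ , moves ∘ sym ∘ injective M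
    where
    open Rotation rot
    isEdge′ : ∀ z → adj H z (match M (σ ⟨$⟩ʳ z)) ≡ true
    isEdge′ z = [ (λ σz≡z → subst (λ t → Adj z t ≡ true) (sym σz≡z) (isEdge M z)) , proj₁ ]
                  (follows z)
    M′ : OneFactor H
    M′ = record
      { match = match M ∘ (σ ⟨$⟩ʳ_) ; injective = ⟨$⟩ʳ-injective σ ∘ injective M ; isEdge = isEdge′ }

  TwoFactorsDifferAt⊎OffCycle : ∀ v →
                                TwoFactorsDifferAt v ⊎ OffCycle (Strict Adj) (Strict (flip Adj)) v
  TwoFactorsDifferAt⊎OffCycle v with Cycle⊎OutClosure (strict? Adj) (Strict-irreflexive Adj) v
  ... | inj₁ cycle = inj₁ (Rotation⇒TwoFactorsDifferAt (Cycle.rotation cycle))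
  ... | inj₂ F with Cycle⊎OutClosure (strict? (flip Adj)) (Strict-irreflexive (flip Adj)) v
  ...   | inj₁ cycle′ = ⊥-elim (OutClosure⇒¬Cycle (Strict-flip Adj) F cycle′)
  ...   | inj₂ B      = inj₂ (F , B)

  Adj-outdegree : ∀ {k} → (∀ x → k ≤ degA H x) → ∀ x → k ≤ ∣ tabulate (Adj x) ∣
  Adj-outdegree k≤degA x = ℕ.≤-trans (k≤degA x)
    (injection⇒∣p∣≤∣q∣ partner⁻¹-injective (tabulate (adj H x)) (tabulate (Adj x))
                       (∈-tabulate⁺ ∘ Adj-partner⁻¹ ∘ ∈-tabulate⁻))
    where
    partner⁻¹ : Fin n → Fin n
    partner⁻¹ b = proj₁ (injective⇒surjective (injective M) b)
    partner∘partner⁻¹ : ∀ b → match M (partner⁻¹ b) ≡ b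
    partner∘partner⁻¹ b = proj₂ (injective⇒surjective (injective M) b)
    partner⁻¹-injective : Injective _≡_ _≡_ partner⁻¹
    partner⁻¹-injective {b} {b′} e =
      trans (sym (partner∘partner⁻¹ b)) (trans (cong (match M) e) (partner∘partner⁻¹ b′))
    Adj-partner⁻¹ : ∀ {b} → adj H x b ≡ true → Adj x (partner⁻¹ b) ≡ true
    Adj-partner⁻¹ {b} = subst (λ t → adj H x t ≡ true) (sym (partner∘partner⁻¹ b))

lemma10 : (k : ℕ) → 2 ≤ k → (H : Bigraph (2 * k + 1)) →
          IsSTBigraph (2 * k + 1) k H → OneFactor H →
          ∃ λ (v′ : Fin (2 * k + 1)) → (v : Fin (2 * k + 1)) → v ≢ v′ →
            Σ (OneFactor H) λ M₁ → Σ (OneFactor H) λ M₂ →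
              match M₁ v ≢ match M₂ v
lemma10 k 2≤k H (k≤degA , k≤degB) M =
  all-but-one (fromℕ< (ℕ.m≤n+m 1 (2 * k))) (TwoFactorsDifferAt⊎OffCycle M)
              (OffCycle-unique (Strict-flip (Adj M)) large large′)
  where
  large : ∀ {w} (F : OutClosure (Strict (Adj M)) w) → k ≤ ∣ OutClosure.set F ∣
  large = OutClosure-size (Adj M) 2≤k (Adj-outdegree M k≤degA)
  large′ : ∀ {w} (B : OutClosure (Strict (flip (Adj M))) w) → k ≤ ∣ OutClosure.set B ∣
  large′ = OutClosure-size (flip (Adj M)) 2≤k (k≤degB ∘ match M)
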